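{- For every bouquet $\Phi$ and every context $\Xi$: $\Phi,\Xi\{\Phi\}\equiv\Phi,\Xi\{\}$.
   Context: Fix a countable set $\mathcal{V}$ of variables and a first-order signature: a countable set $\mathcal{P}$ of predicate symbols with arities $\mathrm{ar}:\mathcal{P}\to\mathbb{N}$. Flowers and gardens by mutual induction: atoms $p(\vec x)$ ($\vec x\in\mathcal V^{\mathrm{ar}(p)}$) are flowers; if $\mathbf{x}\subset\mathcal{V}$ is finite (a sprinkler) and $\Phi$ a finite multiset of flowers (a bouquet), $\mathbf{x}\cdot\Phi$ is a garden; if $\gamma$ is a garden (pistil) and $\Delta$ a finite multiset of gardens (petals), $\gamma\rhd\Delta$ is a flower, also written $\gamma\rhd\delta_1;\dots;\delta_n$. $\emptyset\cdot\Phi$ is written $\Phi$; $\emptyset$ is the empty bouquet; comma is multiset union. Free variables: $\mathrm{fv}(p(\vec x))$ = variables of $\vec x$; $\mathrm{fv}(\Phi)=\bigcup\mathrm{fv}(\phi)$; $\mathrm{fv}(\mathbf{x}\cdot\Phi)=\mathrm{fv}(\Phi)\setminus\mathbf{x}$; $\mathrm{fv}(\mathbf{x}\cdot\Phi\rhd\Delta)=\mathrm{fv}(\mathbf{x}\cdot\Phi)\cup\bigcup_{\mathbf{y}\cdot\Psi\in\Delta}\mathrm{fv}((\mathbf{x}\cup\mathbf{y})\cdot\Psi)$. Bound variables: $\mathrm{bv}(p(\vec x))=\emptyset$, $\mathrm{bv}(\Phi)=\bigcup\mathrm{bv}(\phi)$, $\mathrm{bv}(\mathbf x\cdot\Phi)=\mathbf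 x\cup\mathrm{bv}(\Phi)$, $\mathrm{bv}(\gamma\rhd\Delta)=\mathrm{bv}(\gamma)\cup\bigcup_{\delta\in\Delta}\mathrm{bv}(\delta)$. Standing convention: every bouquet considered (in particular $\Phi,\Xi\{\Phi\}$) has pairwise distinct binders and $\mathrm{bv}\cap\mathrm{fv}=\emptyset$. Contexts: $\Xi::=\Psi,\xi$, $\xi::=\Box\mid(\mathbf x\cdot\Xi\rhd\Delta)\mid(\gamma\rhd\mathbf x\cdot\Xi;\Delta)$ ($\Psi$ a bouquet, $\gamma$ a garden, $\Delta$ a corolla); $\Xi\{\Psi\}$ replaces the hole $\Box$ by bouquet $\Psi$, $\Xi\{\}$ by $\emptyset$. Semantics: $f[R\mapsto g]$ equals $g$ on $R$ and $f$ elsewhere. A Kripke structure $(W,\le,(M_w)_{w\in W})$ has a preorder $\le$ on worlds and for each $w$ a nonempty domain $M_w$ and relations $[\![p]\!]_w\subseteq M_w^{\mathrm{ar}(p)}$, with $M_w\subseteq M_{w'}$ and $[\![p]\!]_w\subseteq[\![p]\!]_{w'}$ when $w\le w'$. A $w$-evaluation is $e:\mathcal V\to M_w$. Forcing: $w\Vdash_e p(x_1,\dots,x_n)$ iff $(e(x_1),\dots,e(x_n))\in[\![p]\!]_w$; $w\Vdash_e\Phi$ iff $w\Vdash_e\phi$ for all $\phi\in\Phi$; $w\Vdash_e(\mathbf x\cdot\Phi\rhd\mathbf x_1\cdot\Phi_1;\dots;\mathbf x_n\cdot\Phi_n)$ iff for every $w'\ge w$ and $w'$-evaluation $e'$ with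 $w'\Vdash_{e[\mathbf x\mapsto e']}\Phi$, there are $i$ and a $w'$-evaluation $e''$ with $w'\Vdash_{e[\mathbf x\mapsto e'][\mathbf x_i\mapsto e'']}\Phi_i$. $\Phi\models\Psi$ means that in every Kripke structure, at every world $w$ and $w$-evaluation $e$, $w\Vdash_e\Phi$ implies $w\Vdash_e\Psi$; $\Phi\equiv\Psi$ means both directions hold. -}

module Defs where

open import Data.Nat using (ℕ; _≟_)
open import Data.Bool using (if_then_else_)
open import Data.List using (List; []; _∷_; _++_; [_])
open import Data.List.Membership.Propositional using (_∈_)
open import Data.List.Membership.DecPropositional _≟_ using (_∈?_)
open import Data.List.Relation.Unary.Unique.Propositional using (Unique)
open import Data.Vec using (Vec)
import Data.Vec as Vec
import Data.Vec.Membership.Propositional as VecMem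
open import Data.Product using (Σ; _×_; ∃)
open import Data.Sum using (_⊎_)
open import Data.Empty using (⊥)
open import Data.Unit using (⊤)
open import Relation.Nullary using (¬_; does)

Var : Set
Var = ℕ

-- Sprinklers: finite sets of variables, represented as lists.
Sprinkler : Set
Sprinkler = List Var

module Syntax (ar : ℕ → ℕ) where

  mutual
    data Flower : Set where
      atom : (p : ℕ) → Vec Var (ar p) → Flower
      _▷_  : Garden → List Garden → Flower   -- pistil ▷ corolla (multiset of petals)

    data Garden : Set where
      _·_ : Sprinkler → List Flower → Garden

  -- bouquets and corollas: finite multisets, represented as lists
  Bouquet : Set
  Bouquet = List Flower

  Corolla : Set
  Corolla = List Garden

  mutual
    data FreeF (v : Var) : Flower → Set where
      atomF  : ∀ {p xs} → v VecMem.∈ xs → FreeF v (atom p xs)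
      pistF  : ∀ {γ Δ} → FreeG v γ → FreeF v (γ ▷ Δ)
      petalF : ∀ {xs Φ ys Ψ Δ} → (ys · Ψ) ∈ Δ → ¬ (v ∈ (xs ++ ys)) → FreeB v Ψ →
               FreeF v ((xs · Φ) ▷ Δ)

    data FreeB (v : Var) : Bouquet → Set where
      inB : ∀ {φ Φ} → φ ∈ Φ → FreeF v φ → FreeB v Φ

    data FreeG (v : Var) : Garden → Set where
      inG : ∀ {xs Φ} → ¬ (v ∈ xs) → FreeB v Φ → FreeG v (xs · Φ)

  -- Bound variables (as a list, so that repetitions = reused binders)

  mutual
    bvF : Flower → List Var
    bvF (atom p xs) = []
    bvF (γ ▷ Δ) = bvG γ ++ bvC Δ

    bvB : Bouquet → List Var
    bvB [] = []
    bvB (φ ∷ Φ) = bvF φ ++ bvB Φ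

    bvG : Garden → List Var
    bvG (xs · Φ) = xs ++ bvB Φ

    bvC : Corolla → List Var
    bvC [] = []
    bvC (δ ∷ Δ) = bvG δ ++ bvC Δ

  DistinctBinders : Bouquet → Set
  DistinctBinders Φ = Unique (bvB Φ)

  BvFvDisjoint : Bouquet → Set
  BvFvDisjoint Φ = ∀ v → v ∈ bvB Φ → FreeB v Φ → ⊥

  WellFormed : Bouquet → Set
  WellFormed Φ = DistinctBinders Φ × BvFvDisjoint Φ

  -- Contexts  Ξ ::= Ψ, ξ      ξ ::= □ | (x · Ξ ▷ Δ) | (γ ▷ x · Ξ ; Δ)

  mutual
    data Ctx : Set where
      _,,_ : Bouquet → CtxI → Ctx

    data CtxI : Set where
      □     : CtxI
      pistC : Sprinkler → Ctx → Corolla → CtxI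
      petC  : Garden → Sprinkler → Ctx → Corolla → CtxI

  mutual
    fill : Ctx → Bouquet → Bouquet
    fill (Ψ' ,, ξ) Ψ = Ψ' ++ fillI ξ Ψ

    fillI : CtxI → Bouquet → Bouquet
    fillI □ Ψ = Ψ
    fillI (pistC xs Ξ Δ) Ψ = [ (xs · fill Ξ Ψ) ▷ Δ ]
    fillI (petC γ xs Ξ Δ) Ψ = [ γ ▷ ((xs · fill Ξ Ψ) ∷ Δ) ]

  -- Kripke structures.  Domains are subsets M_w of a common carrier D,
  -- so that M_w ⊆ M_w' is literal inclusion.

  record Kripke : Set₁ where
    field
      W      : Set
      _≤_    : W → W → Set
      ≤-refl : ∀ {w} → w ≤ w
      ≤-trans : ∀ {u v w} → u ≤ v → v ≤ w → u ≤ w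
      D      : Set
      M      : W → D → Set
      M-nonempty : ∀ w → ∃ λ d → M w d
      M-mono : ∀ {w w'} → w ≤ w' → ∀ {d} → M w d → M w' d
      ⟦_⟧    : (p : ℕ) → W → Vec D (ar p) → Set
      ⟦⟧-dom : ∀ p w ds → ⟦ p ⟧ w ds → ∀ {d} → d VecMem.∈ ds → M w d
      ⟦⟧-mono : ∀ p {w w'} → w ≤ w' → ∀ ds → ⟦ p ⟧ w ds → ⟦ p ⟧ w' ds

  module _ (K : Kripke) where
    open Kripke K

    Eval : W → (Var → D) → Set
    Eval w e = ∀ v → M w (e v)

    override : (Var → D) → Sprinkler → (Var → D) → (Var → D)
    override f R g v = if does (v ∈? R) then g v else f v

    mutual
      forceF : W → (Var → D) → Flower → Set
      forceF w e (atom p xs) = ⟦ p ⟧ w (Vec.map e xs)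
      forceF w e ((xs · Φ) ▷ Δ) =
        ∀ w' → w ≤ w' → (e' : Var → D) → Eval w' e' →
          forceB w' (override e xs e') Φ → forceC w' (override e xs e') Δ

      forceB : W → (Var → D) → Bouquet → Set
      forceB w e [] = ⊤
      forceB w e (φ ∷ Φ) = forceF w e φ × forceB w e Φ

      forceC : W → (Var → D) → Corolla → Set
      forceC w e [] = ⊥
      forceC w e ((ys · Ψ) ∷ Δ) =
        (Σ (Var → D) λ e'' → Eval w e'' × forceB w (override e ys e'') Ψ)
        ⊎ forceC w e Δ

  _⊨_ : Bouquet → Bouquet → Set₁
  Φ ⊨ Ψ = (K : Kripke) → (w : Kripke.W K) → (e : Var → Kripke.D K) →
          Eval K w e → forceB K w e Φ → forceB K w e Ψ

  _≣_ : Bouquet → Bouquet → Set₁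
  Φ ≣ Ψ = (Φ ⊨ Ψ) × (Ψ ⊨ Φ)

{-# OPTIONS --safe #-}
module Submission where

-- Forcing is monotone along ≤ and depends only on the free variables of what is forced.
-- So if w ⊩ₑ Φ, then Φ is still forced at every world and evaluation met while descending
-- into Ξ: those are later worlds with e overridden on binders of Ξ, which capture no free
-- variable of Φ.  There Φ is equivalent to the empty bouquet, and forcing is a congruence
-- for both kinds of context holes.

open import Defs
open import Data.Nat using (ℕ; _≟_)
open import Data.List using (List; []; _∷_; _++_)
open import Data.List.Relation.Unary.Any using (Any; here; there)
open import Data.List.Membership.Propositional using (_∉_; find)
open import Data.List.Membership.Propositional.Properties
  using (∈-++⁺ˡ; ∈-++⁺ʳ; ∈-++⁻)
open import Data.List.Membership.DecPropositional _≟_ using (_∈?_)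
open import Data.List.Relation.Binary.Subset.Propositional using (_⊆_)
open import Data.Vec using (Vec; map)
import Data.Vec.Relation.Unary.Any as VecAny
import Data.Vec.Membership.Propositional as VecMem
open import Data.Product using (_×_; _,_; map₂)
open import Data.Product.Function.NonDependent.Propositional using (_×-⇔_)
open import Data.Sum using (inj₁; inj₂; [_,_]; map₁)
open import Data.Unit using (⊤; tt)
open import Function using (_∘_; _⇔_; mk⇔; Equivalence)
open import Function.Construct.Identity using (⇔-id)
open import Relation.Nullary using (yes; no; contradiction)
open import Relation.Binary.PropositionalEquality using (_≡_; refl; sym; cong₂; subst)

open Equivalence using (to; from)

×-congʳ-⇔ : ∀ {A B C : Set} → (A → B ⇔ C) → (A × B) ⇔ (A × C)
×-congʳ-⇔ B⇔C = mk⇔ (λ (a , b) → a , to (B⇔C a) b) (λ (a , c) → a , from (B⇔C a) c)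

∉-++⁺ : ∀ {v : Var} {xs ys} → v ∉ xs → v ∉ ys → v ∉ xs ++ ys
∉-++⁺ {xs = xs} v∉xs v∉ys = [ v∉xs , v∉ys ] ∘ ∈-++⁻ xs

module Deiteration (ar : ℕ → ℕ) where
  open Syntax ar

  _#_ : List Var → Bouquet → Set
  xs # Φ = ∀ {v} → FreeB v Φ → v ∉ xs

  #-⊆ : ∀ {xs ys Φ} → xs ⊆ ys → ys # Φ → xs # Φ
  #-⊆ xs⊆ys ys#Φ fr = ys#Φ fr ∘ xs⊆ys

  bvB-++⁺ʳ : ∀ Φ {Ψ} → bvB Ψ ⊆ bvB (Φ ++ Ψ)
  bvB-++⁺ʳ []      = λ v∈Ψ → v∈Ψ
  bvB-++⁺ʳ (φ ∷ Φ) = ∈-++⁺ʳ (bvF φ) ∘ bvB-++⁺ʳ Φ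

  FreeB-++⁺ˡ : ∀ {v Φ Ψ} → FreeB v Φ → FreeB v (Φ ++ Ψ)
  FreeB-++⁺ˡ (inB φ∈Φ fr) = inB (∈-++⁺ˡ φ∈Φ) fr

  FreeF-petal : ∀ {v xs Φ Δ} → v ∉ xs → Any (FreeG v) Δ → FreeF v ((xs · Φ) ▷ Δ)
  FreeF-petal v∉xs fr with find fr
  ... | ys · Ψ , δ∈Δ , inG v∉ys frΨ = petalF δ∈Δ (∉-++⁺ v∉xs v∉ys) frΨ

  module Forcing (K : Kripke) where
    open Kripke K

    _[_↦_] : (Var → D) → Sprinkler → (Var → D) → (Var → D)
    e [ xs ↦ g ] = override K e xs g

    _⊩ᶠ⟨_⟩_ : W → (Var → D) → Flower → Set
    w ⊩ᶠ⟨ e ⟩ φ = forceF K w e φ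

    _⊩⟨_⟩_ : W → (Var → D) → Bouquet → Set
    w ⊩⟨ e ⟩ Φ = forceB K w e Φ

    _⊩ᶜ⟨_⟩_ : W → (Var → D) → Corolla → Set
    w ⊩ᶜ⟨ e ⟩ Δ = forceC K w e Δ

    override-∉ : ∀ e xs g v → v ∉ xs → (e [ xs ↦ g ]) v ≡ e v
    override-∉ e xs g v v∉xs with v ∈? xs
    ... | yes v∈xs = contradiction v∈xs v∉xs
    ... | no _     = refl

    override-cong : ∀ e e' xs g v → (v ∉ xs → e v ≡ e' v) →
                    (e [ xs ↦ g ]) v ≡ (e' [ xs ↦ g ]) v
    override-cong e e' xs g v agree with v ∈? xs
    ... | yes _   = refl
    ... | no v∉xs = agree v∉xs

    map-cong-∈ : ∀ {n} {e e' : Var → D} (xs : Vec Var n) →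
                 (∀ {v} → v VecMem.∈ xs → e v ≡ e' v) → map e xs ≡ map e' xs
    map-cong-∈ Vec.[]       agree = refl
    map-cong-∈ (x Vec.∷ xs) agree =
      cong₂ Vec._∷_ (agree (VecAny.here refl)) (map-cong-∈ xs (agree ∘ VecAny.there))

    forceF-mono : ∀ {w w' e} φ → w ≤ w' → w ⊩ᶠ⟨ e ⟩ φ → w' ⊩ᶠ⟨ e ⟩ φ
    forceF-mono (atom p xs)    w≤w' fφ              = ⟦⟧-mono p w≤w' _ fφ
    forceF-mono ((xs · Φ) ▷ Δ) w≤w' fφ w'' w'≤w'' = fφ w'' (≤-trans w≤w' w'≤w'')

    forceB-mono : ∀ {w w' e} Φ → w ≤ w' → w ⊩⟨ e ⟩ Φ → w' ⊩⟨ e ⟩ Φ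
    forceB-mono []      w≤w' _         = tt
    forceB-mono (φ ∷ Φ) w≤w' (fφ , fΦ) = forceF-mono φ w≤w' fφ , forceB-mono Φ w≤w' fΦ

    mutual
      forceF-cong : ∀ {w e e'} φ → (∀ {v} → FreeF v φ → e v ≡ e' v) →
                    w ⊩ᶠ⟨ e ⟩ φ → w ⊩ᶠ⟨ e' ⟩ φ
      forceF-cong {w} (atom p xs) agree = subst (⟦ p ⟧ w) (map-cong-∈ xs (agree ∘ atomF))
      forceF-cong {e = e} {e'} ((xs · Φ) ▷ Δ) agree fφ w' w≤w' g eval fΦ =
        forceC-cong Δ agree-petals (fφ w' w≤w' g eval (forceB-cong Φ agree-pistil fΦ))
        where
        agree-pistil : ∀ {v} → FreeB v Φ → (e' [ xs ↦ g ]) v ≡ (e [ xs ↦ g ]) v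
        agree-pistil {v} fr =
          sym (override-cong e e' xs g v (λ v∉xs → agree (pistF (inG v∉xs fr))))
        agree-petals : ∀ {v} → Any (FreeG v) Δ → (e [ xs ↦ g ]) v ≡ (e' [ xs ↦ g ]) v
        agree-petals {v} fr = override-cong e e' xs g v (λ v∉xs → agree (FreeF-petal v∉xs fr))

      forceB-cong : ∀ {w e e'} Φ → (∀ {v} → FreeB v Φ → e v ≡ e' v) →
                    w ⊩⟨ e ⟩ Φ → w ⊩⟨ e' ⟩ Φ
      forceB-cong []      agree _         = tt
      forceB-cong (φ ∷ Φ) agree (fφ , fΦ) =
        forceF-cong φ (agree ∘ inB (here refl)) fφ ,
        forceB-cong Φ (λ { (inB φ∈Φ fr) → agree (inB (there φ∈Φ) fr) }) fΦ

      forceC-cong : ∀ {w e e'} Δ → (∀ {v} → Any (FreeG v) Δ → e v ≡ e' v) →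
                    w ⊩ᶜ⟨ e ⟩ Δ → w ⊩ᶜ⟨ e' ⟩ Δ
      forceC-cong {e = e} {e'} ((ys · Ψ) ∷ Δ) agree (inj₁ (g , eval , fΨ)) =
        inj₁ (g , eval , forceB-cong Ψ agree-petal fΨ)
        where
        agree-petal : ∀ {v} → FreeB v Ψ → (e [ ys ↦ g ]) v ≡ (e' [ ys ↦ g ]) v
        agree-petal {v} fr = override-cong e e' ys g v (λ v∉ys → agree (here (inG v∉ys fr)))
      forceC-cong ((_ · _) ∷ Δ) agree (inj₂ fΔ) = inj₂ (forceC-cong Δ (agree ∘ there) fΔ)

    forceB-override-# : ∀ {w w' e xs Φ} g → xs # Φ → w ≤ w' → w ⊩⟨ e ⟩ Φ →
                        w' ⊩⟨ e [ xs ↦ g ] ⟩ Φ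
    forceB-override-# {e = e} {xs} {Φ} g xs#Φ w≤w' fΦ =
      forceB-cong Φ (λ {v} fr → sym (override-∉ e xs g v (xs#Φ fr))) (forceB-mono Φ w≤w' fΦ)

    forceB-++-congʳ : ∀ {w e} Φ {Ψ₁ Ψ₂} → (w ⊩⟨ e ⟩ Φ → w ⊩⟨ e ⟩ Ψ₁ ⇔ w ⊩⟨ e ⟩ Ψ₂) →
                      w ⊩⟨ e ⟩ (Φ ++ Ψ₁) ⇔ w ⊩⟨ e ⟩ (Φ ++ Ψ₂)
    forceB-++-congʳ []      Ψ₁⇔Ψ₂ = Ψ₁⇔Ψ₂ tt
    forceB-++-congʳ (φ ∷ Φ) Ψ₁⇔Ψ₂ =
      ×-congʳ-⇔ λ fφ → forceB-++-congʳ Φ (λ fΦ → Ψ₁⇔Ψ₂ (fφ , fΦ))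

    ▷-pistil-cong : ∀ {w e Φ₁ Φ₂} xs Δ →
                    (∀ {w'} → w ≤ w' → ∀ g →
                       w' ⊩⟨ e [ xs ↦ g ] ⟩ Φ₁ ⇔ w' ⊩⟨ e [ xs ↦ g ] ⟩ Φ₂) →
                    w ⊩ᶠ⟨ e ⟩ ((xs · Φ₁) ▷ Δ) ⇔ w ⊩ᶠ⟨ e ⟩ ((xs · Φ₂) ▷ Δ)
    ▷-pistil-cong xs Δ Φ₁⇔Φ₂ = mk⇔
      (λ fφ w' w≤w' g eval → fφ w' w≤w' g eval ∘ from (Φ₁⇔Φ₂ w≤w' g))
      (λ fφ w' w≤w' g eval → fφ w' w≤w' g eval ∘ to (Φ₁⇔Φ₂ w≤w' g))

    ▷-petal-cong : ∀ {w e Φ₁ Φ₂} ys Θ xs Δ →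
                   (∀ {w'} → w ≤ w' → ∀ g g' →
                      w' ⊩⟨ e [ ys ↦ g ] [ xs ↦ g' ] ⟩ Φ₁ ⇔ w' ⊩⟨ e [ ys ↦ g ] [ xs ↦ g' ] ⟩ Φ₂) →
                   w ⊩ᶠ⟨ e ⟩ ((ys · Θ) ▷ ((xs · Φ₁) ∷ Δ)) ⇔ w ⊩ᶠ⟨ e ⟩ ((ys · Θ) ▷ ((xs · Φ₂) ∷ Δ))
    ▷-petal-cong ys Θ xs Δ Φ₁⇔Φ₂ = mk⇔
      (λ fφ w' w≤w' g eval → map₁ (map₂ (map₂ (to (Φ₁⇔Φ₂ w≤w' g _)))) ∘ fφ w' w≤w' g eval)
      (λ fφ w' w≤w' g eval → map₁ (map₂ (map₂ (from (Φ₁⇔Φ₂ w≤w' g _)))) ∘ fφ w' w≤w' g eval)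

    module _ (Φ : Bouquet) where
      mutual
        forceB-fill-erase : ∀ {w e} Ξ → bvB (fill Ξ Φ) # Φ → w ⊩⟨ e ⟩ Φ →
                            w ⊩⟨ e ⟩ fill Ξ Φ ⇔ w ⊩⟨ e ⟩ fill Ξ []
        forceB-fill-erase (Ψ ,, ξ) bv#Φ fΦ =
          forceB-++-congʳ Ψ (λ _ → forceB-fillI-erase ξ (#-⊆ (bvB-++⁺ʳ Ψ) bv#Φ) fΦ)

        forceB-fillI-erase : ∀ {w e} ξ → bvB (fillI ξ Φ) # Φ → w ⊩⟨ e ⟩ Φ →
                             w ⊩⟨ e ⟩ fillI ξ Φ ⇔ w ⊩⟨ e ⟩ fillI ξ []
        forceB-fillI-erase □ _ fΦ = mk⇔ (λ _ → tt) (λ _ → fΦ)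
        forceB-fillI-erase (pistC xs Ξ Δ) bv#Φ fΦ =
          ▷-pistil-cong xs Δ (λ w≤w' g →
            forceB-fill-erase Ξ Ξ#Φ (forceB-override-# g xs#Φ w≤w' fΦ))
          ×-⇔ ⇔-id ⊤
          where
          xs#Φ : xs # Φ
          xs#Φ = #-⊆ (∈-++⁺ˡ ∘ ∈-++⁺ˡ ∘ ∈-++⁺ˡ) bv#Φ
          Ξ#Φ : bvB (fill Ξ Φ) # Φ
          Ξ#Φ = #-⊆ (∈-++⁺ˡ ∘ ∈-++⁺ˡ ∘ ∈-++⁺ʳ xs) bv#Φ
        forceB-fillI-erase (petC (ys · Θ) xs Ξ Δ) bv#Φ fΦ =
          ▷-petal-cong ys Θ xs Δ (λ w≤w' g g' →
            forceB-fill-erase Ξ Ξ#Φ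
              (forceB-override-# g' xs#Φ ≤-refl (forceB-override-# g ys#Φ w≤w' fΦ)))
          ×-⇔ ⇔-id ⊤
          where
          petal⊆bv : xs ++ bvB (fill Ξ Φ) ⊆ bvB (fillI (petC (ys · Θ) xs Ξ Δ) Φ)
          petal⊆bv = ∈-++⁺ˡ ∘ ∈-++⁺ʳ (ys ++ bvB Θ) ∘ ∈-++⁺ˡ
          ys#Φ : ys # Φ
          ys#Φ = #-⊆ (∈-++⁺ˡ ∘ ∈-++⁺ˡ ∘ ∈-++⁺ˡ) bv#Φ
          xs#Φ : xs # Φ
          xs#Φ = #-⊆ (petal⊆bv ∘ ∈-++⁺ˡ) bv#Φ
          Ξ#Φ : bvB (fill Ξ Φ) # Φ
          Ξ#Φ = #-⊆ (petal⊆bv ∘ ∈-++⁺ʳ xs) bv#Φ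

  ⊨-deiteration : ∀ Φ Ξ → bvB (fill Ξ Φ) # Φ → (Φ ++ fill Ξ Φ) ≣ (Φ ++ fill Ξ [])
  ⊨-deiteration Φ Ξ bv#Φ =
    (λ K _ _ _ → to (deiteration K)) , (λ K _ _ _ → from (deiteration K))
    where
    deiteration : ∀ K {w e} → forceB K w e (Φ ++ fill Ξ Φ) ⇔ forceB K w e (Φ ++ fill Ξ [])
    deiteration K = forceB-++-congʳ Φ (forceB-fill-erase Φ Ξ bv#Φ)
      where open Forcing K

mainTheorem14 : (ar : ℕ → ℕ) → (Φ : Syntax.Bouquet ar) → (Ξ : Syntax.Ctx ar) →
    Syntax.WellFormed ar Φ →
    Syntax.WellFormed ar (Syntax.fill ar Ξ Φ) →
    Syntax.BvFvDisjoint ar (Φ ++ Syntax.fill ar Ξ Φ) →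
    Syntax._≣_ ar (Φ ++ Syntax.fill ar Ξ Φ) (Φ ++ Syntax.fill ar Ξ [])
mainTheorem14 ar Φ Ξ _ _ bv∩fv≡∅ =
  ⊨-deiteration Φ Ξ (λ fr v∈bv → bv∩fv≡∅ _ (bvB-++⁺ʳ Φ v∈bv) (FreeB-++⁺ˡ fr))
  where open Deiteration ar
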